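{- Let $w$ be a homogeneous polynomial of degree $n$ in $\mathbb{Z}\langle \mathbf{a},\mathbf{b}\rangle$. Then \begin{align*} \Theta(w\cdot \mathbf{c}) &= (1+q^{n+1})\cdot \Theta(w),\\ \Theta(G(w)) &= q\cdot [n]\cdot \Theta(w),\\ \Theta(\mathrm{Pyr}(w)) &= [n+2]\cdot \Theta(w),\\ \Theta(\mathrm{Bipyr}(w)) &= [2]\cdot[n+1]\cdot \Theta(w). \end{align*}
   Context: $\mathbb{Z}\langle \mathbf{a},\mathbf{b}\rangle$ is the ring of polynomials in non-commuting variables $\mathbf{a},\mathbf{b}$ with integer coefficients. The Major MacMahon map $\Theta:\mathbb{Z}\langle \mathbf{a},\mathbf{b}\rangle\to\mathbb{Z}[q]$ is the linear map defined on a monomial $u_1u_2\cdots u_n$ (each $u_i\in\{\mathbf{a},\mathbf{b}\}$) by $\Theta(u_1\cdots u_n)=\prod_{i:\,u_i=\mathbf{b}} q^{i}$ (so $\Theta(1)=1$). Let $\mathbf{c}=\mathbf{a}+\mathbf{b}$. $G$ and $D$ are the derivations (linear maps satisfying the Leibniz rule $X(uv)=X(u)v+uX(v)$) of $\mathbb{Z}\langle \mathbf{a},\mathbf{b}\rangle$ determined by $G(1)=0$, $G(\mathbf{a})=\mathbf{b}\mathbf{a}$, $G(\mathbf{b})=\mathbf{a}\mathbf{b}$, and $D(1)=0$, $D(\mathbf{a})=D(\mathbf{b})=\mathbf{a}\mathbf{b}+\mathbf{b}\mathbf{a}$. The pyramid and bipyramid operators are $\mathrm{Pyr}(w)=G(w)+w\cdot\mathbf{c}$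 and $\mathrm{Bipyr}(w)=D(w)+\mathbf{c}\cdot w$. Here $[k]=1+q+\cdots+q^{k-1}$. -}

module Defs where

open import Data.Nat as ℕ using (ℕ; zero; suc)
open import Data.Integer as ℤ using (ℤ; +_; 0ℤ; 1ℤ)
open import Data.List using (List; []; _∷_; _++_; map; length; concatMap)
open import Data.Product using (_×_; _,_)
open import Relation.Binary.PropositionalEquality using (_≡_)
open import Relation.Nullary using (¬_)

-- Univariate integer polynomials ℤ[q] as coefficient lists
-- (constant term first); equality is coefficientwise (trailing zeros
-- are irrelevant).

Polyq : Set
Polyq = List ℤ

coeff : Polyq → ℕ → ℤ
coeff []       _       = 0ℤ
coeff (x ∷ p)  zero    = x
coeff (x ∷ p)  (suc i) = coeff p i

infix 4 _≈q_
_≈q_ : Polyq → Polyq → Set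
p ≈q r = ∀ i → coeff p i ≡ coeff r i

infixl 6 _+q_
_+q_ : Polyq → Polyq → Polyq
[]      +q r       = r
p       +q []      = p
(x ∷ p) +q (y ∷ r) = (x ℤ.+ y) ∷ (p +q r)

scaleq : ℤ → Polyq → Polyq
scaleq c = map (c ℤ.*_)

infixl 7 _*q_
_*q_ : Polyq → Polyq → Polyq
[]      *q r = []
(x ∷ p) *q r = scaleq x r +q (0ℤ ∷ (p *q r))

qpow : ℕ → Polyq
qpow zero    = 1ℤ ∷ []
qpow (suc k) = 0ℤ ∷ qpow k

qint : ℕ → Polyq
qint zero    = []
qint (suc k) = 1ℤ ∷ qint k

-- ℤ⟨a,b⟩ : finite ℤ-linear combinations of words in letters a, b.

data Letter : Set where
  a b : Letter

Word : Set
Word = List Letter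

NCPoly : Set
NCPoly = List (ℤ × Word)

Homogeneous : ℕ → NCPoly → Set
Homogeneous n [] = Data.Unit.⊤
  where import Data.Unit
Homogeneous n ((k , u) ∷ w) = (¬ k ≡ 0ℤ → length u ≡ n) × Homogeneous n w

linExt : (Word → NCPoly) → NCPoly → NCPoly
linExt f = concatMap (λ { (k , u) → map (λ { (k' , v) → (k ℤ.* k' , v) }) (f u) })

infixl 7 _·_
_·_ : NCPoly → NCPoly → NCPoly
w · v = concatMap (λ { (k , u) → map (λ { (k' , u') → (k ℤ.* k' , u ++ u') }) v }) w

infixl 6 _⊕_
_⊕_ : NCPoly → NCPoly → NCPoly
_⊕_ = _++_

𝐚 𝐛 𝐜 : NCPoly
𝐚 = (1ℤ , a ∷ []) ∷ []
𝐛 = (1ℤ , b ∷ []) ∷ []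
𝐜 = 𝐚 ⊕ 𝐛

derivWord : (Letter → NCPoly) → Word → NCPoly
derivWord δ []      = []
derivWord δ (x ∷ u) = (δ x · ((1ℤ , u) ∷ [])) ⊕ (((1ℤ , x ∷ []) ∷ []) · derivWord δ u)

derivation : (Letter → NCPoly) → NCPoly → NCPoly
derivation δ = linExt (derivWord δ)

Gδ : Letter → NCPoly
Gδ a = 𝐛 · 𝐚
Gδ b = 𝐚 · 𝐛

Dδ : Letter → NCPoly
Dδ _ = (𝐚 · 𝐛) ⊕ (𝐛 · 𝐚)

G D : NCPoly → NCPoly
G = derivation Gδ
D = derivation Dδ

Pyr Bipyr : NCPoly → NCPoly
Pyr w   = G w ⊕ (w · 𝐜)
Bipyr w = D w ⊕ (𝐜 · w)

-- Major MacMahon map: Θ(u₁⋯uₙ) = ∏_{i : uᵢ = b} q^i, extended linearly.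

ΘwordFrom : ℕ → Word → Polyq
ΘwordFrom i []      = qpow 0
ΘwordFrom i (a ∷ u) = ΘwordFrom (suc i) u
ΘwordFrom i (b ∷ u) = qpow i *q ΘwordFrom (suc i) u

Θword : Word → Polyq
Θword = ΘwordFrom 1

Θ : NCPoly → Polyq
Θ []            = []
Θ ((k , u) ∷ w) = scaleq k (Θword u) +q Θ w

-- Write Θₛ for the MacMahon map with positions counted from s, so Θ = Θ₁. Shifting the
-- positions of a word by its length makes Θₛ multiplicative on homogeneous products,
-- Θₛ(w · v) = Θₛ(w) Θₙ₊ₛ(v) for w of degree n, which gives the identity for w · 𝐜 and
-- computes Θ₁(𝐜 · w) = [2] Θ₂(w). For a derivation δ sending letters to quadratic
-- polynomials, the Leibniz rule δ(x u) = δ(x) u + x δ(u) turns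
-- Θₛ(δ u) + cₛ Θₛ₊₁(u) = c₍|u|+s₎ Θₛ(u) into an induction on u, provided c satisfies
-- one recurrence per letter; cₛ = [s] − 1 works for G and cₛ = [2][s] for D. The
-- pyramid and bipyramid identities then follow by adding the two contributions.
module Submission where

open import Defs
open import Data.Nat as ℕ using (ℕ; zero; suc)
import Data.Nat.Properties as ℕₚ
open import Data.Integer as ℤ using (ℤ; 0ℤ; 1ℤ)
import Data.Integer.Properties as ℤₚ
open import Data.List using ([]; _∷_; _++_; map; length)
open import Data.Maybe using (Maybe; just; nothing)
open import Data.Product using (_×_; _,_)
open import Function using (_∘_)
open import Level using (0ℓ)
open import Relation.Binary.PropositionalEquality
open import Relation.Binary.Bundles using (Setoid)
import Relation.Binary.Reasoning.Setoid
open import Relation.Nullary using (yes; no)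
open import Algebra.Bundles using (CommutativeRing)
open import Tactic.RingSolver.Core.AlmostCommutativeRing
  using (AlmostCommutativeRing; fromCommutativeRing)
open import Tactic.RingSolver using (solve-∀)

-- The ring ℤ[q]

coeff-+q : ∀ p r i → coeff (p +q r) i ≡ coeff p i ℤ.+ coeff r i
coeff-+q []      r       i       = sym (ℤₚ.+-identityˡ _)
coeff-+q (x ∷ p) []      i       = sym (ℤₚ.+-identityʳ _)
coeff-+q (x ∷ p) (y ∷ r) zero    = refl
coeff-+q (x ∷ p) (y ∷ r) (suc i) = coeff-+q p r i

coeff-scaleq : ∀ c p i → coeff (scaleq c p) i ≡ c ℤ.* coeff p i
coeff-scaleq c []      i       = sym (ℤₚ.*-zeroʳ c)
coeff-scaleq c (x ∷ p) zero    = refl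
coeff-scaleq c (x ∷ p) (suc i) = coeff-scaleq c p i

negq : Polyq → Polyq
negq = map (ℤ.-_)

coeff-negq : ∀ p i → coeff (negq p) i ≡ ℤ.- coeff p i
coeff-negq []      i       = refl
coeff-negq (x ∷ p) zero    = refl
coeff-negq (x ∷ p) (suc i) = coeff-negq p i

1q : Polyq
1q = qpow 0

tailq : Polyq → Polyq
tailq []      = []
tailq (_ ∷ p) = p

coeff-tailq : ∀ p i → coeff (tailq p) i ≡ coeff p (suc i)
coeff-tailq []      i = refl
coeff-tailq (x ∷ p) i = refl

coeff-*q-zero : ∀ p r → coeff (p *q r) 0 ≡ coeff p 0 ℤ.* coeff r 0
coeff-*q-zero []      r = sym (ℤₚ.*-zeroˡ (coeff r 0))
coeff-*q-zero (x ∷ p) r =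
  trans (coeff-+q (scaleq x r) _ 0) (trans (ℤₚ.+-identityʳ _) (coeff-scaleq x r 0))

coeff-*q-suc : ∀ p r i →
  coeff (p *q r) (suc i) ≡ coeff p 0 ℤ.* coeff r (suc i) ℤ.+ coeff (tailq p *q r) i
coeff-*q-suc []      r i = cong (ℤ._+ 0ℤ) (sym (ℤₚ.*-zeroˡ (coeff r (suc i))))
coeff-*q-suc (x ∷ p) r i =
  trans (coeff-+q (scaleq x r) _ (suc i)) (cong (ℤ._+ _) (coeff-scaleq x r (suc i)))

-- Wrapping _≈q_ in a record makes both sides inferable from a proof.
infix 4 _≋_
record _≋_ (p r : Polyq) : Set where
  constructor mk≋
  field coeff-≡ : p ≈q r
open _≋_ public

≋-refl : ∀ {p} → p ≋ p
≋-refl = mk≋ λ _ → refl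

≋-sym : ∀ {p r} → p ≋ r → r ≋ p
≋-sym (mk≋ e) = mk≋ λ i → sym (e i)

≋-trans : ∀ {p r s} → p ≋ r → r ≋ s → p ≋ s
≋-trans (mk≋ e) (mk≋ f) = mk≋ λ i → trans (e i) (f i)

≋-setoid : Setoid 0ℓ 0ℓ
≋-setoid = record
  { Carrier = Polyq ; _≈_ = _≋_
  ; isEquivalence = record { refl = ≋-refl ; sym = ≋-sym ; trans = ≋-trans } }

open Relation.Binary.Reasoning.Setoid ≋-setoid

∷-cong : ∀ {x y p r} → x ≡ y → p ≋ r → x ∷ p ≋ y ∷ r
∷-cong x≡y (mk≋ e) = mk≋ λ { zero → x≡y ; (suc i) → e i }

0∷[]≋[] : 0ℤ ∷ [] ≋ []
0∷[]≋[] = mk≋ λ { zero → refl ; (suc i) → refl }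

+q-cong : ∀ {p p′ r r′} → p ≋ p′ → r ≋ r′ → p +q r ≋ p′ +q r′
+q-cong {p} {p′} {r} {r′} (mk≋ e) (mk≋ f) = mk≋ λ i →
  trans (coeff-+q p r i) (trans (cong₂ ℤ._+_ (e i) (f i)) (sym (coeff-+q p′ r′ i)))

negq-cong : ∀ {p p′} → p ≋ p′ → negq p ≋ negq p′
negq-cong {p} {p′} (mk≋ e) = mk≋ λ i →
  trans (coeff-negq p i) (trans (cong ℤ.-_ (e i)) (sym (coeff-negq p′ i)))

coeff-*q-congʳ : ∀ p p′ r → p ≈q p′ → p *q r ≈q p′ *q r
coeff-*q-congʳ p p′ r e zero rewrite coeff-*q-zero p r | coeff-*q-zero p′ r =
  cong (ℤ._* _) (e 0)
coeff-*q-congʳ p p′ r e (suc i) rewrite coeff-*q-suc p r i | coeff-*q-suc p′ r i =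
  cong₂ ℤ._+_ (cong (ℤ._* _) (e 0)) (coeff-*q-congʳ (tailq p) (tailq p′) r tail≈ i)
  where
  tail≈ : tailq p ≈q tailq p′
  tail≈ j = trans (coeff-tailq p j) (trans (e (suc j)) (sym (coeff-tailq p′ j)))

+q-assoc : ∀ p r s → (p +q r) +q s ≋ p +q (r +q s)
+q-assoc p r s = mk≋ go
  where
  go : (p +q r) +q s ≈q p +q (r +q s)
  go i rewrite coeff-+q (p +q r) s i | coeff-+q p r i | coeff-+q p (r +q s) i | coeff-+q r s i =
    ℤₚ.+-assoc (coeff p i) (coeff r i) (coeff s i)

+q-comm : ∀ p r → p +q r ≋ r +q p
+q-comm p r = mk≋ λ i →
  trans (coeff-+q p r i) (trans (ℤₚ.+-comm (coeff p i) _) (sym (coeff-+q r p i)))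

+q-identityʳ : ∀ p → p +q [] ≋ p
+q-identityʳ p = mk≋ λ i → trans (coeff-+q p [] i) (ℤₚ.+-identityʳ (coeff p i))

+q-inverseˡ : ∀ p → negq p +q p ≋ []
+q-inverseˡ p = mk≋ λ i →
  trans (coeff-+q (negq p) p i)
        (trans (cong (ℤ._+ coeff p i) (coeff-negq p i)) (ℤₚ.+-inverseˡ (coeff p i)))

+q-inverseʳ : ∀ p → p +q negq p ≋ []
+q-inverseʳ p = mk≋ λ i →
  trans (coeff-+q p (negq p) i)
        (trans (cong (ℤ._+_ (coeff p i)) (coeff-negq p i)) (ℤₚ.+-inverseʳ (coeff p i)))

+q-interchange : ∀ p r s t → (p +q r) +q (s +q t) ≋ (p +q s) +q (r +q t)
+q-interchange p r s t = mk≋ go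
  where
  open import Algebra.Properties.CommutativeSemigroup ℤₚ.+-commutativeSemigroup using (interchange)
  go : (p +q r) +q (s +q t) ≈q (p +q s) +q (r +q t)
  go i rewrite coeff-+q (p +q r) (s +q t) i | coeff-+q (p +q s) (r +q t) i
             | coeff-+q p r i | coeff-+q s t i | coeff-+q p s i | coeff-+q r t i =
    interchange (coeff p i) (coeff r i) (coeff s i) (coeff t i)

scaleq-cong : ∀ c {p r} → p ≋ r → scaleq c p ≋ scaleq c r
scaleq-cong c {p} {r} (mk≋ e) = mk≋ λ i →
  trans (coeff-scaleq c p i) (trans (cong (c ℤ.*_) (e i)) (sym (coeff-scaleq c r i)))

scaleq-+q : ∀ c p r → scaleq c (p +q r) ≋ scaleq c p +q scaleq c r
scaleq-+q c p r = mk≋ go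
  where
  go : scaleq c (p +q r) ≈q scaleq c p +q scaleq c r
  go i rewrite coeff-scaleq c (p +q r) i | coeff-+q (scaleq c p) (scaleq c r) i
             | coeff-+q p r i | coeff-scaleq c p i | coeff-scaleq c r i =
    ℤₚ.*-distribˡ-+ c (coeff p i) (coeff r i)

scaleq-* : ∀ c d p → scaleq (c ℤ.* d) p ≋ scaleq c (scaleq d p)
scaleq-* c d p = mk≋ go
  where
  go : scaleq (c ℤ.* d) p ≈q scaleq c (scaleq d p)
  go i rewrite coeff-scaleq (c ℤ.* d) p i | coeff-scaleq c (scaleq d p) i | coeff-scaleq d p i =
    ℤₚ.*-assoc c d (coeff p i)

scaleq-0 : ∀ p → scaleq 0ℤ p ≋ []
scaleq-0 p = mk≋ (coeff-scaleq 0ℤ p)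

scaleq-1 : ∀ p → scaleq 1ℤ p ≋ p
scaleq-1 p = mk≋ λ i → trans (coeff-scaleq 1ℤ p i) (ℤₚ.*-identityˡ (coeff p i))

+q-congˡ : ∀ p {r r′} → r ≋ r′ → p +q r ≋ p +q r′
+q-congˡ p = +q-cong (≋-refl {p})

+q-congʳ : ∀ {p p′} r → p ≋ p′ → p +q r ≋ p′ +q r
+q-congʳ r p≋p′ = +q-cong p≋p′ (≋-refl {r})

*q-zeroʳ : ∀ p → p *q [] ≋ []
*q-zeroʳ []      = ≋-refl
*q-zeroʳ (x ∷ p) = ≋-trans (∷-cong refl (*q-zeroʳ p)) 0∷[]≋[]

*q-∷ : ∀ p x r → p *q (x ∷ r) ≋ scaleq x p +q (0ℤ ∷ p *q r)
*q-∷ []      x r = ≋-sym 0∷[]≋[]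
*q-∷ (y ∷ p) x r = ∷-cong (cong (ℤ._+ 0ℤ) (ℤₚ.*-comm y x)) (begin
  Y +q p *q (x ∷ r)          ≈⟨ +q-congˡ Y (*q-∷ p x r) ⟩
  Y +q (X +q (0ℤ ∷ p *q r))  ≈⟨ +q-assoc Y X _ ⟨
  (Y +q X) +q (0ℤ ∷ p *q r)  ≈⟨ +q-congʳ (0ℤ ∷ p *q r) (+q-comm Y X) ⟩
  (X +q Y) +q (0ℤ ∷ p *q r)  ≈⟨ +q-assoc X Y _ ⟩
  X +q (Y +q (0ℤ ∷ p *q r))  ∎)
  where
  X = scaleq x p
  Y = scaleq y r

*q-comm : ∀ p r → p *q r ≋ r *q p
*q-comm []      r = ≋-sym (*q-zeroʳ r)
*q-comm (x ∷ p) r =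
  ≋-trans (+q-congˡ (scaleq x r) (∷-cong refl (*q-comm p r))) (≋-sym (*q-∷ r x p))

*q-distribˡ : ∀ s p r → s *q (p +q r) ≋ s *q p +q s *q r
*q-distribˡ []      p r = ≋-refl
*q-distribˡ (x ∷ s) p r = ≋-trans
  (+q-cong (scaleq-+q x p r) (∷-cong (sym (ℤₚ.+-identityʳ 0ℤ)) (*q-distribˡ s p r)))
  (+q-interchange (scaleq x p) (scaleq x r) _ _)

*q-distribʳ : ∀ s p r → (p +q r) *q s ≋ p *q s +q r *q s
*q-distribʳ s p r = ≋-trans (*q-comm (p +q r) s)
  (≋-trans (*q-distribˡ s p r) (+q-cong (*q-comm s p) (*q-comm s r)))

scaleq-*q : ∀ c p r → scaleq c p *q r ≋ scaleq c (p *q r)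
scaleq-*q c []      r = ≋-refl
scaleq-*q c (x ∷ p) r = begin
  scaleq (c ℤ.* x) r +q (0ℤ ∷ scaleq c p *q r)
    ≈⟨ +q-cong (scaleq-* c x r) (∷-cong refl (scaleq-*q c p r)) ⟩
  scaleq c (scaleq x r) +q (0ℤ ∷ scaleq c (p *q r))
    ≈⟨ +q-congˡ (scaleq c (scaleq x r)) (∷-cong (ℤₚ.*-zeroʳ c) ≋-refl) ⟨
  scaleq c (scaleq x r) +q scaleq c (0ℤ ∷ p *q r)
    ≈⟨ scaleq-+q c (scaleq x r) _ ⟨
  scaleq c (scaleq x r +q (0ℤ ∷ p *q r)) ∎

*q-assoc : ∀ p r s → (p *q r) *q s ≋ p *q (r *q s)
*q-assoc []      r s = ≋-refl
*q-assoc (x ∷ p) r s = begin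
  (scaleq x r +q (0ℤ ∷ p *q r)) *q s
    ≈⟨ *q-distribʳ s (scaleq x r) _ ⟩
  scaleq x r *q s +q (0ℤ ∷ p *q r) *q s
    ≈⟨ +q-cong (scaleq-*q x r s) (+q-congʳ _ (scaleq-0 s)) ⟩
  scaleq x (r *q s) +q (0ℤ ∷ (p *q r) *q s)
    ≈⟨ +q-congˡ (scaleq x (r *q s)) (∷-cong refl (*q-assoc p r s)) ⟩
  scaleq x (r *q s) +q (0ℤ ∷ p *q (r *q s)) ∎

*q-identityˡ : ∀ p → 1q *q p ≋ p
*q-identityˡ p = ≋-trans (+q-cong (scaleq-1 p) 0∷[]≋[]) (+q-identityʳ p)

*q-identityʳ : ∀ p → p *q 1q ≋ p
*q-identityʳ p = ≋-trans (*q-comm p _) (*q-identityˡ p)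

*q-cong : ∀ {p p′ r r′} → p ≋ p′ → r ≋ r′ → p *q r ≋ p′ *q r′
*q-cong {p} {p′} {r} {r′} (mk≋ p≈p′) (mk≋ r≈r′) = begin
  p *q r   ≈⟨ mk≋ (coeff-*q-congʳ p p′ r p≈p′) ⟩
  p′ *q r  ≈⟨ *q-comm p′ r ⟩
  r *q p′  ≈⟨ mk≋ (coeff-*q-congʳ r r′ p′ r≈r′) ⟩
  r′ *q p′ ≈⟨ *q-comm r′ p′ ⟩
  p′ *q r′ ∎

*q-congˡ : ∀ p {r r′} → r ≋ r′ → p *q r ≋ p *q r′
*q-congˡ p = *q-cong (≋-refl {p})

*q-congʳ : ∀ {p p′} r → p ≋ p′ → p *q r ≋ p′ *q r
*q-congʳ r p≋p′ = *q-cong p≋p′ (≋-refl {r})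

scaleq-*qˡ : ∀ k p r → scaleq k (p *q r) ≋ p *q scaleq k r
scaleq-*qˡ k p r = begin
  scaleq k (p *q r)  ≈⟨ scaleq-cong k (*q-comm p r) ⟩
  scaleq k (r *q p)  ≈⟨ scaleq-*q k r p ⟨
  scaleq k r *q p    ≈⟨ *q-comm (scaleq k r) p ⟩
  p *q scaleq k r    ∎

ℤ[q] : CommutativeRing 0ℓ 0ℓ
ℤ[q] = record
  { Carrier = Polyq ; _≈_ = _≋_ ; _+_ = _+q_ ; _*_ = _*q_ ; -_ = negq ; 0# = [] ; 1# = 1q
  ; isCommutativeRing = record
    { isRing = record
      { +-isAbelianGroup = record
        { isGroup = record
          { isMonoid = record
            { isSemigroup = record
              { isMagma = record
                { isEquivalence = Setoid.isEquivalence ≋-setoid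
                ; ∙-cong = +q-cong }
              ; assoc = +q-assoc }
            ; identity = (λ p → ≋-refl) , +q-identityʳ }
          ; inverse = +q-inverseˡ , +q-inverseʳ
          ; ⁻¹-cong = negq-cong }
        ; comm = +q-comm }
      ; *-cong = *q-cong
      ; *-assoc = *q-assoc
      ; *-identity = *q-identityˡ , *q-identityʳ
      ; distrib = *q-distribˡ , *q-distribʳ }
    ; *-comm = *q-comm } }

[]≋? : ∀ p → Maybe ([] ≋ p)
[]≋? []      = just ≋-refl
[]≋? (x ∷ p) with x ℤ.≟ 0ℤ | []≋? p
... | yes refl | just []≋p = just (≋-trans (≋-sym 0∷[]≋[]) (∷-cong refl []≋p))
... | _        | _         = nothing

ℤ[q]-almost : AlmostCommutativeRing 0ℓ 0ℓ
ℤ[q]-almost = fromCommutativeRing ℤ[q] []≋?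

open import Algebra.Properties.CommutativeSemigroup (CommutativeRing.*-commutativeSemigroup ℤ[q])
  using (x∙yz≈y∙xz)

q : Polyq
q = qpow 1

q*q≋0∷ : ∀ p → q *q p ≋ 0ℤ ∷ p
q*q≋0∷ p = +q-cong (scaleq-0 p) (∷-cong refl (*q-identityˡ p))

qpow-suc : ∀ j → qpow (suc j) ≋ q *q qpow j
qpow-suc j = ≋-sym (q*q≋0∷ (qpow j))

qint-suc : ∀ j → qint (suc j) ≋ 1q +q q *q qint j
qint-suc j = ≋-sym (+q-congˡ 1q (q*q≋0∷ (qint j)))

qint-sucʳ : ∀ j → qint (suc j) ≋ qint j +q qpow j
qint-sucʳ zero    = ≋-refl
qint-sucʳ (suc j) = ∷-cong refl (qint-sucʳ j)

qint-pyramid : ∀ n → qint (suc (suc n)) ≋ q *q qint n +q (1q +q qpow (suc n))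
qint-pyramid n = begin
  qint (suc (suc n))                   ≈⟨ qint-suc (suc n) ⟩
  1q +q q *q qint (suc n)              ≈⟨ +q-congˡ 1q (*q-congˡ q (qint-sucʳ n)) ⟩
  1q +q q *q (qint n +q qpow n)        ≈⟨ regroup q (qint n) (qpow n) ⟩
  q *q qint n +q (1q +q q *q qpow n)   ≈⟨ +q-congˡ (q *q qint n) (+q-congˡ 1q (qpow-suc n)) ⟨
  q *q qint n +q (1q +q qpow (suc n))  ∎
  where
  regroup : ∀ Q I P → 1q +q Q *q (I +q P) ≋ Q *q I +q (1q +q Q *q P)
  regroup = solve-∀ ℤ[q]-almost

-- Linear extension to ℤ⟨a,b⟩

lin : (Word → Polyq) → NCPoly → Polyq
lin g []            = []
lin g ((k , u) ∷ w) = scaleq k (g u) +q lin g w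

lin-cong : ∀ {g h} → (∀ u → g u ≋ h u) → ∀ w → lin g w ≋ lin h w
lin-cong g≋h []            = ≋-refl
lin-cong g≋h ((k , u) ∷ w) = +q-cong (scaleq-cong k (g≋h u)) (lin-cong g≋h w)

lin-cong-homogeneous : ∀ {g h} n → (∀ u → length u ≡ n → g u ≋ h u) →
  ∀ w → Homogeneous n w → lin g w ≋ lin h w
lin-cong-homogeneous n g≋h [] _ = ≋-refl
lin-cong-homogeneous {g} {h} n g≋h ((k , u) ∷ w) (∣u∣≡n , hw) =
  +q-cong scaled (lin-cong-homogeneous n g≋h w hw)
  where
  scaled : scaleq k (g u) ≋ scaleq k (h u)
  scaled with k ℤ.≟ 0ℤ
  ... | yes refl = ≋-trans (scaleq-0 (g u)) (≋-sym (scaleq-0 (h u)))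
  ... | no k≢0   = scaleq-cong k (g≋h u (∣u∣≡n k≢0))

lin-++ : ∀ g w v → lin g (w ++ v) ≋ lin g w +q lin g v
lin-++ g []            v = ≋-refl
lin-++ g ((k , u) ∷ w) v =
  ≋-trans (+q-congˡ (scaleq k (g u)) (lin-++ g w v)) (≋-sym (+q-assoc (scaleq k (g u)) _ _))

lin-+q : ∀ g h w → lin (λ u → g u +q h u) w ≋ lin g w +q lin h w
lin-+q g h []            = ≋-refl
lin-+q g h ((k , u) ∷ w) =
  ≋-trans (+q-cong (scaleq-+q k (g u) (h u)) (lin-+q g h w))
          (+q-interchange (scaleq k (g u)) (scaleq k (h u)) _ _)

lin-*q : ∀ p g w → lin (λ u → p *q g u) w ≋ p *q lin g w
lin-*q p g []            = ≋-sym (*q-zeroʳ p)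
lin-*q p g ((k , u) ∷ w) = begin
  scaleq k (p *q g u) +q lin (λ u → p *q g u) w
    ≈⟨ +q-cong (scaleq-*qˡ k p (g u)) (lin-*q p g w) ⟩
  p *q scaleq k (g u) +q p *q lin g w
    ≈⟨ *q-distribˡ p (scaleq k (g u)) _ ⟨
  p *q (scaleq k (g u) +q lin g w) ∎

lin-map-scaled : ∀ g k f (t : ℤ × Word → ℤ × Word) →
  (∀ k′ v → t (k′ , v) ≡ (k ℤ.* k′ , f v)) →
  ∀ w → lin g (map t w) ≋ scaleq k (lin (g ∘ f) w)
lin-map-scaled g k f t t-def [] = ≋-refl
lin-map-scaled g k f t t-def ((k′ , v) ∷ w) rewrite t-def k′ v = begin
  scaleq (k ℤ.* k′) (g (f v)) +q lin g (map t w)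
    ≈⟨ +q-cong (scaleq-* k k′ (g (f v))) (lin-map-scaled g k f t t-def w) ⟩
  scaleq k (scaleq k′ (g (f v))) +q scaleq k (lin (g ∘ f) w)
    ≈⟨ scaleq-+q k (scaleq k′ (g (f v))) _ ⟨
  scaleq k (scaleq k′ (g (f v)) +q lin (g ∘ f) w) ∎

lin-linExt : ∀ g f w → lin g (linExt f w) ≋ lin (lin g ∘ f) w
lin-linExt g f []            = ≋-refl
lin-linExt g f ((k , u) ∷ w) = ≋-trans (lin-++ g (map _ (f u)) (linExt f w))
  (+q-cong (lin-map-scaled g k (λ v → v) _ (λ _ _ → refl) (f u)) (lin-linExt g f w))

lin-· : ∀ g w v → lin g (w · v) ≋ lin (λ u → lin (λ u′ → g (u ++ u′)) v) w
lin-· g []            v = ≋-refl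
lin-· g ((k , u) ∷ w) v = ≋-trans (lin-++ g (map _ v) (w · v))
  (+q-cong (lin-map-scaled g k (u ++_) _ (λ _ _ → refl) v) (lin-· g w v))

-- The MacMahon map with positions counted from s

Θfrom : ℕ → NCPoly → Polyq
Θfrom s = lin (ΘwordFrom s)

Θ≡Θfrom1 : ∀ w → Θ w ≡ Θfrom 1 w
Θ≡Θfrom1 []            = refl
Θ≡Θfrom1 ((k , u) ∷ w) = cong (scaleq k (Θword u) +q_) (Θ≡Θfrom1 w)

Θfrom-monomial : ∀ s u → Θfrom s ((1ℤ , u) ∷ []) ≋ ΘwordFrom s u
Θfrom-monomial s u = ≋-trans (+q-identityʳ _) (scaleq-1 (ΘwordFrom s u))

ΘwordFrom-++ : ∀ s u v → ΘwordFrom s (u ++ v) ≋ ΘwordFrom s u *q ΘwordFrom (length u ℕ.+ s) v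
ΘwordFrom-++ s []      v = ≋-sym (*q-identityˡ (ΘwordFrom s v))
ΘwordFrom-++ s (a ∷ u) v rewrite sym (ℕₚ.+-suc (length u) s) = ΘwordFrom-++ (suc s) u v
ΘwordFrom-++ s (b ∷ u) v rewrite sym (ℕₚ.+-suc (length u) s) =
  ≋-trans (*q-congˡ (qpow s) (ΘwordFrom-++ (suc s) u v))
          (≋-sym (*q-assoc (qpow s) (ΘwordFrom (suc s) u) _))

Θfrom-· : ∀ n s w v → Homogeneous n w → Θfrom s (w · v) ≋ Θfrom s w *q Θfrom (n ℕ.+ s) v
Θfrom-· n s w v hw = begin
  Θfrom s (w · v)                                     ≈⟨ lin-· (ΘwordFrom s) w v ⟩
  lin (λ u → lin (λ u′ → ΘwordFrom s (u ++ u′)) v) w  ≈⟨ lin-cong-homogeneous n factor w hw ⟩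
  lin (λ u → V *q ΘwordFrom s u) w                    ≈⟨ lin-*q V (ΘwordFrom s) w ⟩
  V *q Θfrom s w                                      ≈⟨ *q-comm V _ ⟩
  Θfrom s w *q V                                      ∎
  where
  V = Θfrom (n ℕ.+ s) v
  factor : ∀ u → length u ≡ n → lin (λ u′ → ΘwordFrom s (u ++ u′)) v ≋ V *q ΘwordFrom s u
  factor u refl = begin
    lin (λ u′ → ΘwordFrom s (u ++ u′)) v                           ≈⟨ lin-cong (ΘwordFrom-++ s u) v ⟩
    lin (λ u′ → ΘwordFrom s u *q ΘwordFrom (length u ℕ.+ s) u′) v  ≈⟨ lin-*q (ΘwordFrom s u) _ v ⟩
    ΘwordFrom s u *q V                                             ≈⟨ *q-comm (ΘwordFrom s u) V ⟩
    V *q ΘwordFrom s u                                             ∎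

Θfrom-𝐜 : ∀ s → Θfrom s 𝐜 ≋ 1q +q qpow s
Θfrom-𝐜 s = +q-cong (scaleq-1 1q)
  (≋-trans (+q-identityʳ _) (≋-trans (scaleq-1 _) (*q-identityʳ (qpow s))))

Θfrom-𝐛·𝐚 : ∀ s → Θfrom s (𝐛 · 𝐚) ≋ qpow s
Θfrom-𝐛·𝐚 s = ≋-trans (+q-identityʳ _) (≋-trans (scaleq-1 _) (*q-identityʳ (qpow s)))

Θfrom-𝐚·𝐛 : ∀ s → Θfrom s (𝐚 · 𝐛) ≋ qpow (suc s)
Θfrom-𝐚·𝐛 s = ≋-trans (+q-identityʳ _) (≋-trans (scaleq-1 _) (*q-identityʳ (qpow (suc s))))

-- Θ of a derivation

module Θ-derivation (δ : Letter → NCPoly) (δ-homogeneous : ∀ x → Homogeneous 2 (δ x)) where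

  Θfrom-derivWord-∷ : ∀ s x u →
    Θfrom s (derivWord δ (x ∷ u))
      ≋ Θfrom s (δ x) *q ΘwordFrom (2 ℕ.+ s) u
        +q ΘwordFrom s (x ∷ []) *q Θfrom (suc s) (derivWord δ u)
  Θfrom-derivWord-∷ s x u =
    ≋-trans (lin-++ (ΘwordFrom s) (δ x · ((1ℤ , u) ∷ [])) (𝐱 · derivWord δ u)) (+q-cong
      (≋-trans (Θfrom-· 2 s (δ x) _ (δ-homogeneous x))
               (*q-congˡ (Θfrom s (δ x)) (Θfrom-monomial (2 ℕ.+ s) u)))
      (≋-trans (Θfrom-· 1 s 𝐱 (derivWord δ u) ((λ _ → refl) , _))
               (*q-congʳ (Θfrom (suc s) (derivWord δ u)) (Θfrom-monomial s (x ∷ [])))))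
    where
    𝐱 = (1ℤ , x ∷ []) ∷ []

  module _ (c : ℕ → Polyq)
    (c-a : ∀ s → Θfrom s (δ a) +q c s ≋ c (suc s))
    (c-b : ∀ s → Θfrom s (δ b) +q c s *q qpow (suc s) ≋ qpow s *q c (suc s)) where

    Θfrom-derivWord : ∀ s u →
      Θfrom s (derivWord δ u) +q c s *q ΘwordFrom (suc s) u ≋ c (length u ℕ.+ s) *q ΘwordFrom s u
    Θfrom-derivWord s [] = ≋-refl
    Θfrom-derivWord s (a ∷ u) = begin
      Θfrom s (derivWord δ (a ∷ u)) +q c s *q T  ≈⟨ +q-congʳ (c s *q T) (Θfrom-derivWord-∷ s a u) ⟩
      (A *q T +q 1q *q X) +q c s *q T            ≈⟨ regroup A T X (c s) ⟩
      X +q (A +q c s) *q T                       ≈⟨ +q-congˡ X (*q-congʳ T (c-a s)) ⟩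
      X +q c (suc s) *q T                        ≈⟨ Θfrom-derivWord (suc s) u ⟩
      c (m ℕ.+ suc s) *q U                       ≡⟨ cong (λ k → c k *q U) (ℕₚ.+-suc m s) ⟩
      c (suc m ℕ.+ s) *q U                       ∎
      where
      m = length u
      A = Θfrom s (δ a)
      T = ΘwordFrom (2 ℕ.+ s) u
      U = ΘwordFrom (suc s) u
      X = Θfrom (suc s) (derivWord δ u)
      regroup : ∀ A T X C → (A *q T +q 1q *q X) +q C *q T ≋ X +q (A +q C) *q T
      regroup = solve-∀ ℤ[q]-almost
    Θfrom-derivWord s (b ∷ u) = begin
      Θfrom s (derivWord δ (b ∷ u)) +q c s *q (Q′ *q T)  ≈⟨ +q-congʳ _ (Θfrom-derivWord-∷ s b u) ⟩
      (B *q T +q (Q *q 1q) *q X) +q c s *q (Q′ *q T)     ≈⟨ regroup B T Q X (c s) Q′ ⟩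
      (B +q c s *q Q′) *q T +q Q *q X                    ≈⟨ +q-congʳ (Q *q X) (*q-congʳ T (c-b s)) ⟩
      Q *q c (suc s) *q T +q Q *q X                      ≈⟨ factor Q (c (suc s)) T X ⟩
      Q *q (X +q c (suc s) *q T)                         ≈⟨ *q-congˡ Q (Θfrom-derivWord (suc s) u) ⟩
      Q *q (c (m ℕ.+ suc s) *q U)                        ≡⟨ cong (λ k → Q *q (c k *q U)) (ℕₚ.+-suc m s) ⟩
      Q *q (c (suc m ℕ.+ s) *q U)                        ≈⟨ x∙yz≈y∙xz Q (c (suc m ℕ.+ s)) U ⟩
      c (suc m ℕ.+ s) *q (Q *q U)                        ∎
      where
      m = length u
      B = Θfrom s (δ b)
      Q = qpow s
      Q′ = qpow (suc s)
      T = ΘwordFrom (2 ℕ.+ s) u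
      U = ΘwordFrom (suc s) u
      X = Θfrom (suc s) (derivWord δ u)
      regroup : ∀ B T Q X C Q′ →
        (B *q T +q (Q *q 1q) *q X) +q C *q (Q′ *q T) ≋ (B +q C *q Q′) *q T +q Q *q X
      regroup = solve-∀ ℤ[q]-almost
      factor : ∀ Q C T X → Q *q C *q T +q Q *q X ≋ Q *q (X +q C *q T)
      factor = solve-∀ ℤ[q]-almost

    Θfrom-derivation : ∀ n s w → Homogeneous n w →
      Θfrom s (derivation δ w) +q c s *q Θfrom (suc s) w ≋ c (n ℕ.+ s) *q Θfrom s w
    Θfrom-derivation n s w hw = begin
      Θfrom s (derivation δ w) +q c s *q Θfrom (suc s) w
        ≈⟨ +q-cong (lin-linExt (ΘwordFrom s) (derivWord δ) w)
                   (≋-sym (lin-*q (c s) (ΘwordFrom (suc s)) w)) ⟩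
      lin (Θfrom s ∘ derivWord δ) w +q lin (λ u → c s *q ΘwordFrom (suc s) u) w
        ≈⟨ lin-+q (Θfrom s ∘ derivWord δ) _ w ⟨
      lin (λ u → Θfrom s (derivWord δ u) +q c s *q ΘwordFrom (suc s) u) w
        ≈⟨ lin-cong-homogeneous n (λ { u refl → Θfrom-derivWord s u }) w hw ⟩
      lin (λ u → c (n ℕ.+ s) *q ΘwordFrom s u) w
        ≈⟨ lin-*q (c (n ℕ.+ s)) (ΘwordFrom s) w ⟩
      c (n ℕ.+ s) *q Θfrom s w ∎

Gδ-homogeneous : ∀ x → Homogeneous 2 (Gδ x)
Gδ-homogeneous a = (λ _ → refl) , _
Gδ-homogeneous b = (λ _ → refl) , _

Dδ-homogeneous : ∀ x → Homogeneous 2 (Dδ x)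
Dδ-homogeneous _ = (λ _ → refl) , (λ _ → refl) , _

module G-coefficients where

  c : ℕ → Polyq
  c s = qint s +q negq 1q

  c-a : ∀ s → Θfrom s (Gδ a) +q c s ≋ c (suc s)
  c-a s = begin
    Θfrom s (𝐛 · 𝐚) +q c s         ≈⟨ +q-congʳ (c s) (Θfrom-𝐛·𝐚 s) ⟩
    qpow s +q (qint s +q negq 1q)   ≈⟨ regroup (qpow s) (qint s) ⟩
    (qint s +q qpow s) +q negq 1q   ≈⟨ +q-congʳ (negq 1q) (qint-sucʳ s) ⟨
    c (suc s)                       ∎
    where
    regroup : ∀ P I → P +q (I +q negq 1q) ≋ (I +q P) +q negq 1q
    regroup = solve-∀ ℤ[q]-almost

  c-b : ∀ s → Θfrom s (Gδ b) +q c s *q qpow (suc s) ≋ qpow s *q c (suc s)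
  c-b s = begin
    Θfrom s (𝐚 · 𝐛) +q c s *q qpow (suc s)
      ≈⟨ +q-cong (≋-trans (Θfrom-𝐚·𝐛 s) (qpow-suc s)) (*q-congˡ (c s) (qpow-suc s)) ⟩
    q *q qpow s +q c s *q (q *q qpow s)
      ≈⟨ regroup q (qpow s) (qint s) ⟩
    qpow s *q ((1q +q q *q qint s) +q negq 1q)
      ≈⟨ *q-congˡ (qpow s) (+q-congʳ (negq 1q) (qint-suc s)) ⟨
    qpow s *q c (suc s) ∎
    where
    regroup : ∀ Q P I → Q *q P +q (I +q negq 1q) *q (Q *q P) ≋ P *q ((1q +q Q *q I) +q negq 1q)
    regroup = solve-∀ ℤ[q]-almost

module D-coefficients where

  c : ℕ → Polyq
  c s = qint 2 *q qint s

  Θfrom-Dδ : ∀ s x → Θfrom s (Dδ x) ≋ q *q qpow s +q qpow s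
  Θfrom-Dδ s x = ≋-trans (lin-++ (ΘwordFrom s) (𝐚 · 𝐛) (𝐛 · 𝐚))
    (+q-cong (≋-trans (Θfrom-𝐚·𝐛 s) (qpow-suc s)) (Θfrom-𝐛·𝐚 s))

  c-a : ∀ s → Θfrom s (Dδ a) +q c s ≋ c (suc s)
  c-a s = begin
    Θfrom s (Dδ a) +q c s                        ≈⟨ +q-congʳ (c s) (Θfrom-Dδ s a) ⟩
    (q *q qpow s +q qpow s) +q qint 2 *q qint s  ≈⟨ regroup q (qpow s) (qint s) ⟩
    qint 2 *q (qint s +q qpow s)                 ≈⟨ *q-congˡ (qint 2) (qint-sucʳ s) ⟨
    c (suc s)                                    ∎
    where
    regroup : ∀ Q P I → (Q *q P +q P) +q (1q +q Q) *q I ≋ (1q +q Q) *q (I +q P)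
    regroup = solve-∀ ℤ[q]-almost

  c-b : ∀ s → Θfrom s (Dδ b) +q c s *q qpow (suc s) ≋ qpow s *q c (suc s)
  c-b s = begin
    Θfrom s (Dδ b) +q c s *q qpow (suc s)
      ≈⟨ +q-cong (Θfrom-Dδ s b) (*q-congˡ (c s) (qpow-suc s)) ⟩
    (q *q qpow s +q qpow s) +q qint 2 *q qint s *q (q *q qpow s)
      ≈⟨ regroup q (qpow s) (qint s) ⟩
    qpow s *q (qint 2 *q (1q +q q *q qint s))
      ≈⟨ *q-congˡ (qpow s) (*q-congˡ (qint 2) (qint-suc s)) ⟨
    qpow s *q c (suc s) ∎
    where
    regroup : ∀ Q P I →
      (Q *q P +q P) +q (1q +q Q) *q I *q (Q *q P) ≋ P *q ((1q +q Q) *q (1q +q Q *q I))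
    regroup = solve-∀ ℤ[q]-almost

-- The four identities

Θfrom-·𝐜 : ∀ n w → Homogeneous n w → Θfrom 1 (w · 𝐜) ≋ (1q +q qpow (suc n)) *q Θfrom 1 w
Θfrom-·𝐜 n w hw = begin
  Θfrom 1 (w · 𝐜)                      ≈⟨ Θfrom-· n 1 w 𝐜 hw ⟩
  W *q Θfrom (n ℕ.+ 1) 𝐜               ≈⟨ *q-congˡ W (Θfrom-𝐜 (n ℕ.+ 1)) ⟩
  W *q (1q +q qpow (n ℕ.+ 1))          ≡⟨ cong (λ k → W *q (1q +q qpow k)) (ℕₚ.+-comm n 1) ⟩
  W *q (1q +q qpow (suc n))            ≈⟨ *q-comm W _ ⟩
  (1q +q qpow (suc n)) *q W            ∎
  where
  W = Θfrom 1 w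

Θfrom-G : ∀ n w → Homogeneous n w → Θfrom 1 (G w) ≋ (q *q qint n) *q Θfrom 1 w
Θfrom-G n w hw = begin
  Θfrom 1 (G w)                             ≈⟨ +q-identityʳ _ ⟨
  Θfrom 1 (G w) +q []                       ≈⟨ +q-congˡ (Θfrom 1 (G w)) (*q-congʳ (Θfrom 2 w) 0∷[]≋[]) ⟨
  Θfrom 1 (G w) +q (0ℤ ∷ []) *q Θfrom 2 w   ≡⟨⟩
  Θfrom 1 (G w) +q c 1 *q Θfrom 2 w         ≈⟨ Θfrom-derivation c c-a c-b n 1 w hw ⟩
  c (n ℕ.+ 1) *q W                          ≡⟨ cong (λ k → c k *q W) (ℕₚ.+-comm n 1) ⟩
  (qint (suc n) +q negq 1q) *q W            ≈⟨ *q-congʳ W (+q-congʳ (negq 1q) (qint-suc n)) ⟩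
  ((1q +q q *q qint n) +q negq 1q) *q W     ≈⟨ *q-congʳ W (cancel (q *q qint n)) ⟩
  (q *q qint n) *q W                        ∎
  where
  open G-coefficients
  open Θ-derivation Gδ Gδ-homogeneous
  W = Θfrom 1 w
  cancel : ∀ X → (1q +q X) +q negq 1q ≋ X
  cancel = solve-∀ ℤ[q]-almost

Θfrom-Pyr : ∀ n w → Homogeneous n w → Θfrom 1 (Pyr w) ≋ qint (suc (suc n)) *q Θfrom 1 w
Θfrom-Pyr n w hw = begin
  Θfrom 1 (G w ⊕ w · 𝐜)                                  ≈⟨ lin-++ (ΘwordFrom 1) (G w) (w · 𝐜) ⟩
  Θfrom 1 (G w) +q Θfrom 1 (w · 𝐜)                       ≈⟨ +q-cong (Θfrom-G n w hw) (Θfrom-·𝐜 n w hw) ⟩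
  (q *q qint n) *q W +q (1q +q qpow (suc n)) *q W        ≈⟨ *q-distribʳ W (q *q qint n) _ ⟨
  (q *q qint n +q (1q +q qpow (suc n))) *q W             ≈⟨ *q-congʳ W (qint-pyramid n) ⟨
  qint (suc (suc n)) *q W                                ∎
  where
  W = Θfrom 1 w

Θfrom-Bipyr : ∀ n w → Homogeneous n w → Θfrom 1 (Bipyr w) ≋ (qint 2 *q qint (suc n)) *q Θfrom 1 w
Θfrom-Bipyr n w hw = begin
  Θfrom 1 (D w ⊕ 𝐜 · w)             ≈⟨ lin-++ (ΘwordFrom 1) (D w) (𝐜 · w) ⟩
  Θfrom 1 (D w) +q Θfrom 1 (𝐜 · w)  ≈⟨ +q-congˡ (Θfrom 1 (D w)) (Θfrom-· 1 1 𝐜 w 𝐜-homogeneous) ⟩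
  Θfrom 1 (D w) +q Θfrom 1 𝐜 *q W₂  ≈⟨ +q-congˡ (Θfrom 1 (D w)) (*q-congʳ W₂ (Θfrom-𝐜 1)) ⟩
  Θfrom 1 (D w) +q qint 2 *q W₂     ≈⟨ +q-congˡ (Θfrom 1 (D w)) (*q-congʳ W₂ (*q-identityʳ (qint 2))) ⟨
  Θfrom 1 (D w) +q c 1 *q W₂        ≈⟨ Θfrom-derivation c c-a c-b n 1 w hw ⟩
  c (n ℕ.+ 1) *q W                  ≡⟨ cong (λ k → c k *q W) (ℕₚ.+-comm n 1) ⟩
  (qint 2 *q qint (suc n)) *q W     ∎
  where
  open D-coefficients
  open Θ-derivation Dδ Dδ-homogeneous
  W = Θfrom 1 w
  W₂ = Θfrom 2 w
  𝐜-homogeneous : Homogeneous 1 𝐜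
  𝐜-homogeneous = (λ _ → refl) , (λ _ → refl) , _

Θ-≈q : ∀ x y r → Θfrom 1 x ≋ r *q Θfrom 1 y → Θ x ≈q r *q Θ y
Θ-≈q x y r eq rewrite Θ≡Θfrom1 x | Θ≡Θfrom1 y = coeff-≡ eq

mainTheorem1 : (n : ℕ) (w : NCPoly) → Homogeneous n w →
    (Θ (w · 𝐜) ≈q (qpow 0 +q qpow (suc n)) *q Θ w)
    × (Θ (G w) ≈q (qpow 1 *q qint n) *q Θ w)
    × (Θ (Pyr w) ≈q qint (suc (suc n)) *q Θ w)
    × (Θ (Bipyr w) ≈q (qint 2 *q qint (suc n)) *q Θ w)
mainTheorem1 n w hw =
    Θ-≈q (w · 𝐜) w (qpow 0 +q qpow (suc n)) (Θfrom-·𝐜 n w hw)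
  , Θ-≈q (G w) w (qpow 1 *q qint n) (Θfrom-G n w hw)
  , Θ-≈q (Pyr w) w (qint (suc (suc n))) (Θfrom-Pyr n w hw)
  , Θ-≈q (Bipyr w) w (qint 2 *q qint (suc n)) (Θfrom-Bipyr n w hw)
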